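{- Let $n\geq1$ and let $\ell$ be an end vertex of the path $P_n$. Then $$T_{\mathrm{Cone}(P_n)}(1,y)=F_{2n}(y),\qquad T_{\mathrm{Cone}^{(+\ell)}(P_n)}(1,y)=F_{2n+1}(y).$$
   Context: $P_n$ is the path on $n$ vertices. For a tree $T$, $\mathrm{Cone}(T)$ is obtained by adding a new cone vertex $v_0$ joined by one edge to each vertex of $T$; for a vertex $u$ of $T$, $\mathrm{Cone}^{(+u)}(T)$ is $\mathrm{Cone}(T)$ with a second edge added parallel to $\{v_0,u\}$. $T_G(x,y)$ is the Tutte polynomial (defined by $T_G=T_{G\setminus e}+T_{G/e}$ for $e$ neither loop nor coloop, $T_G=yT_{G\setminus e}$ for a loop, $T_G=xT_{G/e}$ for a coloop, $T_G=1$ with no edges). The polynomials $F_n(y)\in\mathbb{Z}[y]$ are defined by $F_0(y)=0$, $F_1(y)=1$, and for $n\geq 2$: $F_n(y)=F_{n-1}(y)+F_{n-2}(y)$ if $n$ is even, $F_n(y)=F_{n-1}(y)+yF_{n-2}(y)$ if $n$ is odd. -}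

module Defs where

open import Data.Nat using (ℕ; zero; suc; _≡ᵇ_)
open import Data.Bool using (Bool; true; false; if_then_else_; not)
open import Data.Product using (_×_; _,_)
open import Data.List using (List; []; _∷_; _++_)
open import Data.Integer using (ℤ; _+_; _*_) renaming (+_ to int)

-- Multigraphs: a finite list of edges, each an unordered pair of vertex
-- labels (u , v) with u v : ℕ.  (Isolated vertices do not affect the
-- Tutte polynomial, so the vertex set is left implicit.)
Edge : Set
Edge = ℕ × ℕ

Graph : Set
Graph = List Edge

-- A relabelling of vertices; the graph "E under σ" has edges (σ u , σ v).
-- Contracting an edge {a , b} is realised by merging the class of b into a.
merge : (ℕ → ℕ) → ℕ → ℕ → (ℕ → ℕ)
merge σ a b w = if σ w ≡ᵇ σ b then σ a else σ w

connected : (ℕ → ℕ) → Graph → ℕ → ℕ → Bool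
connected σ []            u v = σ u ≡ᵇ σ v
connected σ ((a , b) ∷ E) u v = connected (merge σ a b) E u v

-- Tutte polynomial evaluated at (x , y), by deletion–contraction on the
-- first edge e = {a , b} of the (relabelled) graph:
--   e a loop      : T_G = y · T_{G∖e}
--   e a coloop    : T_G = x · T_{G/e}
--   otherwise     : T_G = T_{G∖e} + T_{G/e}
--   no edges      : T_G = 1
tutteAux : (ℕ → ℕ) → Graph → ℤ → ℤ → ℤ
tutteAux σ []            x y = int 1
tutteAux σ ((a , b) ∷ E) x y =
  if σ a ≡ᵇ σ b
  then y * tutteAux σ E x y
  else (if not (connected σ E a b)
        then x * tutteAux (merge σ a b) E x y
        else (tutteAux σ E x y + tutteAux (merge σ a b) E x y))

tutte : Graph → ℤ → ℤ → ℤ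
tutte G x y = tutteAux (λ w → w) G x y

-- The path P_n on vertices 0 , … , n-1 : edges {i , i+1}.
pathEdges : ℕ → Graph
pathEdges zero          = []
pathEdges (suc zero)    = []
pathEdges (suc (suc k)) = pathEdges (suc k) ++ ((k , suc k) ∷ [])

spokes : ℕ → ℕ → Graph
spokes c zero    = []
spokes c (suc i) = spokes c i ++ ((c , i) ∷ [])

-- Cone(P_n): cone vertex v₀ = n joined by one edge to each vertex of P_n.
conePath : ℕ → Graph
conePath n = pathEdges n ++ spokes n n

-- Cone^{(+u)}(P_n): a second edge parallel to {v₀ , u}.
conePathPlus : ℕ → ℕ → Graph
conePathPlus n u = conePath n ++ ((n , u) ∷ [])

even : ℕ → Bool
even zero          = true
even (suc zero)    = false
even (suc (suc k)) = even k

F : ℕ → ℤ → ℤ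
F zero                y = int 0
F (suc zero)          y = int 1
F (suc (suc k))       y =
  F (suc k) y + (if even k then int 1 else y) * F k y

module Submission where

-- Compute T(1, y) by deletion–contraction along the path edges
-- {0,1}, {1,2}, … in order. Deleting {u, v} cuts u off the rest of the path, so
-- its spokes end up as a bundle of k parallel edges to the cone vertex, worth
-- 1 + y + ⋯ + y^(k-1); contracting it moves the spokes of v onto u. Hence
-- T(1, y) of a cone over a path is a "fan" polynomial in the spoke
-- multiplicities, fan s (t ∷ ts) = bundle s · fan t ts + fan (t + s) ts. For
-- multiplicities 1, 1, …, 1 (with at most one doubled spoke at an end) the fan
-- value is affine in bundle s, with coefficients obeying
-- a(m+2) = (2 + y) a(m+1) − y a(m), the recurrence of both the even- and the
-- odd-indexed F_n; matching initial values identifies them with F_2n, F_2n+1.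

open import Defs
open import Data.Bool using (true; false; if_then_else_)
open import Data.Empty using (⊥-elim)
open import Data.Integer using (ℤ; _+_; _*_; _-_; _^_) renaming (+_ to int)
import Data.Integer.Properties as ℤₚ
open import Data.Integer.Tactic.RingSolver using (solve-∀)
open import Data.List using (List; []; _∷_; _++_; map; length; replicate; upTo; applyUpTo)
open import Data.List.Properties
  using (length-map; map-++; map-cong-local; ++-identityʳ; ++-assoc; upTo-∷ʳ; applyUpTo-∷ʳ; length-applyUpTo)
open import Data.List.Membership.Propositional using (_∈_; _∉_)
open import Data.List.Membership.Propositional.Properties using (∈-map⁺; ∈-++⁺ˡ; ∈-upTo⁺; ∈-upTo⁻)
open import Data.List.Relation.Unary.All as All using (All; []; _∷_)
open import Data.List.Relation.Unary.All.Properties using (¬Any⇒All¬; All¬⇒¬Any; applyUpTo⁺₁; ++⁺)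
open import Data.List.Relation.Unary.AllPairs using (_∷_)
open import Data.List.Relation.Unary.Unique.Propositional using (Unique)
open import Data.List.Relation.Unary.Unique.Propositional.Properties using (upTo⁺)
open import Data.List.Relation.Unary.Any using (here; there)
open import Data.Nat as ℕ using (ℕ; zero; suc; _≡ᵇ_; _≟_; _≤_; z≤n; s≤s)
import Data.Nat.Properties as ℕₚ
open import Data.List.Membership.DecPropositional ℕ._≟_ using (_∈?_)
open import Data.Product using (_×_; _,_; proj₁; proj₂)
open import Data.Sum using (_⊎_; inj₁; inj₂)
open import Function using (id; _∘_)
open import Relation.Nullary using (yes; no)
open import Relation.Binary.PropositionalEquality
open ≡-Reasoning

≡ᵇ-refl : ∀ n → (n ≡ᵇ n) ≡ true
≡ᵇ-refl n with n ≡ᵇ n | ℕₚ.≡⇒≡ᵇ n n refl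
... | true | _ = refl

≢⇒≡ᵇ-false : ∀ {m n} → m ≢ n → (m ≡ᵇ n) ≡ false
≢⇒≡ᵇ-false {m} {n} m≢n with m ≡ᵇ n | ℕₚ.≡ᵇ⇒≡ m n
... | true | m≡n = ⊥-elim (m≢n (m≡n _))
... | false | _ = refl

-- Relabelling and contraction

relabel : (ℕ → ℕ) → Graph → Graph
relabel σ = map λ (a , b) → σ a , σ b

connected-relabel : ∀ τ σ E u v →
  connected (τ ∘ σ) E u v ≡ connected τ (relabel σ E) (σ u) (σ v)
connected-relabel τ σ []            u v = refl
connected-relabel τ σ ((a , b) ∷ E) u v = connected-relabel (merge τ (σ a) (σ b)) σ E u v

tutteAux-relabel : ∀ τ σ E x y → tutteAux (τ ∘ σ) E x y ≡ tutteAux τ (relabel σ E) x y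
tutteAux-relabel τ σ []            x y = refl
tutteAux-relabel τ σ ((a , b) ∷ E) x y
  rewrite connected-relabel τ σ E a b
        | tutteAux-relabel τ σ E x y
        | tutteAux-relabel (merge τ (σ a) (σ b)) σ E x y = refl

contractAll : (ℕ → ℕ) → Graph → ℕ → ℕ
contractAll σ []            = σ
contractAll σ ((a , b) ∷ E) = contractAll (merge σ a b) E

connected-contractAll : ∀ σ E u v → connected σ E u v ≡ (contractAll σ E u ≡ᵇ contractAll σ E v)
connected-contractAll σ []            u v = refl
connected-contractAll σ ((a , b) ∷ E) u v = connected-contractAll (merge σ a b) E u v

connected-++ : ∀ σ E F u v → connected σ (E ++ F) u v ≡ connected (contractAll σ E) F u v
connected-++ σ []            F u v = refl
connected-++ σ ((a , b) ∷ E) F u v = connected-++ (merge σ a b) E F u v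

merge-source : ∀ σ a b → merge σ a b a ≡ σ a
merge-source σ a b with σ a ≡ᵇ σ b
... | true  = refl
... | false = refl

merge-target : ∀ σ a b → merge σ a b b ≡ σ a
merge-target σ a b rewrite ≡ᵇ-refl (σ b) = refl

merge-into-source : ∀ σ a b w → σ w ≡ σ a → merge σ a b w ≡ σ a
merge-into-source σ a b w σw≡σa with σ w ≡ᵇ σ b
... | true  = refl
... | false = σw≡σa

merge-other : ∀ σ a b w → σ w ≢ σ b → merge σ a b w ≡ σ w
merge-other σ a b w σw≢σb rewrite ≢⇒≡ᵇ-false σw≢σb = refl

-- Stars, paths and cones

star : ℕ → List ℕ → Graph
star c = map (c ,_)

path : List ℕ → Graph
path []           = []
path (u ∷ [])     = []
path (u ∷ v ∷ vs) = (u , v) ∷ path (v ∷ vs)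

relabel-star : ∀ σ c L → relabel σ (star c L) ≡ star (σ c) (map σ L)
relabel-star σ c []      = refl
relabel-star σ c (j ∷ L) = cong ((σ c , σ j) ∷_) (relabel-star σ c L)

relabel-path : ∀ σ vs → relabel σ (path vs) ≡ path (map σ vs)
relabel-path σ []           = refl
relabel-path σ (u ∷ [])     = refl
relabel-path σ (u ∷ v ∷ vs) = cong ((σ u , σ v) ∷_) (relabel-path σ (v ∷ vs))

contractAll-star-leaf : ∀ σ c L w → w ∈ L ⊎ σ w ≡ σ c → contractAll σ (star c L) w ≡ σ c
contractAll-star-leaf σ c []      w (inj₂ σw≡σc) = σw≡σc
contractAll-star-leaf σ c (j ∷ L) w w-leaf =
  trans (contractAll-star-leaf (merge σ c j) c L w (leaf-merge w-leaf)) (merge-source σ c j)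
  where
  leaf-merge : w ∈ j ∷ L ⊎ σ w ≡ σ c → w ∈ L ⊎ merge σ c j w ≡ merge σ c j c
  leaf-merge (inj₁ (here refl)) = inj₂ (trans (merge-target σ c w) (sym (merge-source σ c w)))
  leaf-merge (inj₁ (there w∈L)) = inj₁ w∈L
  leaf-merge (inj₂ σw≡σc)       =
    inj₂ (trans (merge-into-source σ c j w σw≡σc) (sym (merge-source σ c j)))

contractAll-star-apart : ∀ σ c L w → σ w ≢ σ c → All (λ j → σ j ≢ σ w) L →
  contractAll σ (star c L) w ≡ σ w
contractAll-star-apart σ c []      w _      _ = refl
contractAll-star-apart σ c (j ∷ L) w σw≢σc (σj≢σw ∷ apart) =
  trans (contractAll-star-apart (merge σ c j) c L w σ′w≢σ′c (All.map apart-merge apart)) σ′w≡σw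
  where
  σ′w≡σw : merge σ c j w ≡ σ w
  σ′w≡σw = merge-other σ c j w (σj≢σw ∘ sym)
  σ′w≢σ′c : merge σ c j w ≢ merge σ c j c
  σ′w≢σ′c eq = σw≢σc (trans (sym σ′w≡σw) (trans eq (merge-source σ c j)))
  apart-merge : ∀ {i} → σ i ≢ σ w → merge σ c j i ≢ merge σ c j w
  apart-merge {i} σi≢σw rewrite σ′w≡σw with σ i ≡ᵇ σ j
  ... | true  = σw≢σc ∘ sym
  ... | false = σi≢σw

connected-star-leaves : ∀ σ c L u v → u ∈ L ⊎ σ u ≡ σ c → v ∈ L ⊎ σ v ≡ σ c →
  connected σ (star c L) u v ≡ true
connected-star-leaves σ c L u v u-leaf v-leaf
  rewrite connected-contractAll σ (star c L) u v
        | contractAll-star-leaf σ c L u u-leaf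
        | contractAll-star-leaf σ c L v v-leaf = ≡ᵇ-refl (σ c)

connected-star-apart : ∀ σ c L v → σ v ≢ σ c → All (λ j → σ j ≢ σ v) L →
  connected σ (star c L) c v ≡ false
connected-star-apart σ c L v σv≢σc apart
  rewrite connected-contractAll σ (star c L) c v
        | contractAll-star-leaf σ c L c (inj₂ refl)
        | contractAll-star-apart σ c L v σv≢σc apart = ≢⇒≡ᵇ-false (σv≢σc ∘ sym)

path-snoc : ∀ xs a b → path (xs ++ a ∷ b ∷ []) ≡ path (xs ++ a ∷ []) ++ (a , b) ∷ []
path-snoc []            a b = refl
path-snoc (x ∷ [])      a b = refl
path-snoc (x ∷ x′ ∷ xs) a b = cong ((x , x′) ∷_) (path-snoc (x′ ∷ xs) a b)

pathEdges-upTo : ∀ n → pathEdges n ≡ path (upTo n)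
pathEdges-upTo zero          = refl
pathEdges-upTo (suc zero)    = refl
pathEdges-upTo (suc (suc k)) = begin
  pathEdges (suc k) ++ (k , suc k) ∷ []
    ≡⟨ cong (_++ (k , suc k) ∷ []) (pathEdges-upTo (suc k)) ⟩
  path (upTo (suc k)) ++ (k , suc k) ∷ []
    ≡⟨ cong (λ vs → path vs ++ (k , suc k) ∷ []) (sym (upTo-∷ʳ k)) ⟩
  path (upTo k ++ k ∷ []) ++ (k , suc k) ∷ []
    ≡⟨ sym (path-snoc (upTo k) k (suc k)) ⟩
  path (upTo k ++ k ∷ suc k ∷ [])
    ≡⟨ cong path (sym (++-assoc (upTo k) (k ∷ []) (suc k ∷ []))) ⟩
  path ((upTo k ++ k ∷ []) ++ suc k ∷ [])
    ≡⟨ cong (λ vs → path (vs ++ suc k ∷ [])) (upTo-∷ʳ k) ⟩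
  path (upTo (suc k) ++ suc k ∷ [])
    ≡⟨ cong path (upTo-∷ʳ (suc k)) ⟩
  path (upTo (suc (suc k))) ∎

spokes-upTo : ∀ c n → spokes c n ≡ star c (upTo n)
spokes-upTo c zero    = refl
spokes-upTo c (suc n) = begin
  spokes c n ++ (c , n) ∷ []
    ≡⟨ cong (_++ (c , n) ∷ []) (spokes-upTo c n) ⟩
  star c (upTo n) ++ star c (n ∷ [])
    ≡⟨ sym (map-++ (c ,_) (upTo n) (n ∷ [])) ⟩
  star c (upTo n ++ n ∷ [])
    ≡⟨ cong (star c) (upTo-∷ʳ n) ⟩
  star c (upTo (suc n)) ∎

conePath-spokes : ∀ n → conePath n ≡ path (upTo n) ++ star n (upTo n)
conePath-spokes n = cong₂ _++_ (pathEdges-upTo n) (spokes-upTo n n)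

conePathPlus-spokes : ∀ n ℓ → conePathPlus n ℓ ≡ path (upTo n) ++ star n (upTo n ++ ℓ ∷ [])
conePathPlus-spokes n ℓ = begin
  conePath n ++ (n , ℓ) ∷ []
    ≡⟨ cong (_++ (n , ℓ) ∷ []) (conePath-spokes n) ⟩
  (path (upTo n) ++ star n (upTo n)) ++ (n , ℓ) ∷ []
    ≡⟨ ++-assoc (path (upTo n)) (star n (upTo n)) ((n , ℓ) ∷ []) ⟩
  path (upTo n) ++ star n (upTo n) ++ star n (ℓ ∷ [])
    ≡⟨ cong (path (upTo n) ++_) (sym (map-++ (n ,_) (upTo n) (ℓ ∷ []))) ⟩
  path (upTo n) ++ star n (upTo n ++ ℓ ∷ []) ∎

-- Multisets of leaves

∈-∉⇒≢ : ∀ {x z} {L : List ℕ} → x ∈ L → z ∉ L → x ≢ z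
∈-∉⇒≢ {L = L} x∈L z∉L x≡z = z∉L (subst (_∈ L) x≡z x∈L)

count : ℕ → List ℕ → ℕ
count h []      = 0
count h (x ∷ L) = if x ≡ᵇ h then suc (count h L) else count h L

remove : ℕ → List ℕ → List ℕ
remove h []      = []
remove h (x ∷ L) = if x ≡ᵇ h then remove h L else x ∷ remove h L

rename : ℕ → ℕ → ℕ → ℕ
rename h c x = if x ≡ᵇ h then c else x

_∖_ : List ℕ → List ℕ → List ℕ
L ∖ []       = L
L ∖ (v ∷ vs) = remove v (L ∖ vs)

count-≡ : ∀ h L → count h (h ∷ L) ≡ suc (count h L)
count-≡ h L rewrite ≡ᵇ-refl h = refl

count-≢ : ∀ {x h} L → x ≢ h → count h (x ∷ L) ≡ count h L
count-≢ L x≢h rewrite ≢⇒≡ᵇ-false x≢h = refl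

remove-≡ : ∀ h L → remove h (h ∷ L) ≡ remove h L
remove-≡ h L rewrite ≡ᵇ-refl h = refl

remove-≢ : ∀ {x h} L → x ≢ h → remove h (x ∷ L) ≡ x ∷ remove h L
remove-≢ L x≢h rewrite ≢⇒≡ᵇ-false x≢h = refl

rename-≡ : ∀ h c → rename h c h ≡ c
rename-≡ h c rewrite ≡ᵇ-refl h = refl

rename-≢ : ∀ {x h} c → x ≢ h → rename h c x ≡ x
rename-≢ c x≢h rewrite ≢⇒≡ᵇ-false x≢h = refl

count-∉ : ∀ {h} L → h ∉ L → count h L ≡ 0
count-∉ []      h∉L = refl
count-∉ (x ∷ L) h∉L
  rewrite count-≢ L (∈-∉⇒≢ (here refl) h∉L) = count-∉ L (h∉L ∘ there)

count-∈ : ∀ {h} L → h ∈ L → 0 ℕ.< count h L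
count-∈ (x ∷ L) (here refl) rewrite count-≡ x L = s≤s z≤n
count-∈ {h} (x ∷ L) (there h∈L) with x ≟ h
... | yes refl rewrite count-≡ x L = s≤s z≤n
... | no x≢h   rewrite count-≢ L x≢h = count-∈ L h∈L

remove-∉ : ∀ {h} L → h ∉ L → remove h L ≡ L
remove-∉ []      h∉L = refl
remove-∉ (x ∷ L) h∉L
  rewrite remove-≢ L (∈-∉⇒≢ (here refl) h∉L) = cong (x ∷_) (remove-∉ L (h∉L ∘ there))

rename-∉ : ∀ {h} c L → h ∉ L → map (rename h c) L ≡ L
rename-∉ c []      h∉L = refl
rename-∉ c (x ∷ L) h∉L =
  cong₂ _∷_ (rename-≢ c (∈-∉⇒≢ (here refl) h∉L)) (rename-∉ c L (h∉L ∘ there))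

∈-remove⁻ : ∀ {x k} L → x ∈ remove k L → x ∈ L × x ≢ k
∈-remove⁻ {k = k} (z ∷ L) x∈ with z ≟ k
... | yes refl rewrite remove-≡ z L =
  let x∈L , x≢k = ∈-remove⁻ L x∈ in there x∈L , x≢k
... | no z≢k rewrite remove-≢ L z≢k with x∈
...   | here refl = here refl , z≢k
...   | there x∈′ = let x∈L , x≢k = ∈-remove⁻ L x∈′ in there x∈L , x≢k

∈-remove⁺ : ∀ {x k} L → x ∈ L → x ≢ k → x ∈ remove k L
∈-remove⁺ {k = k} (z ∷ L) x∈ x≢k with z ≟ k | x∈
... | yes refl | here refl = ⊥-elim (x≢k refl)
... | yes refl | there x∈L rewrite remove-≡ z L = ∈-remove⁺ L x∈L x≢k
... | no z≢k   | here refl rewrite remove-≢ L z≢k = here refl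
... | no z≢k   | there x∈L rewrite remove-≢ L z≢k = there (∈-remove⁺ L x∈L x≢k)

∉-remove : ∀ {x k} L → x ∉ L → x ∉ remove k L
∉-remove L x∉L = x∉L ∘ proj₁ ∘ ∈-remove⁻ L

remove-∌ : ∀ h L → h ∉ remove h L
remove-∌ h L h∈ = proj₂ (∈-remove⁻ L h∈) refl

∈-rename⁺ : ∀ {x h} c L → x ∈ L → x ≢ h → x ∈ map (rename h c) L
∈-rename⁺ {h = h} c L x∈L x≢h =
  subst (_∈ map (rename h c) L) (rename-≢ c x≢h) (∈-map⁺ (rename h c) x∈L)

∉-rename : ∀ {x h c} L → x ∉ L → x ≢ c → x ∉ map (rename h c) L
∉-rename {h = h} {c} (z ∷ L) x∉ x≢c (here x≡z′) with z ≟ h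
... | yes refl rewrite rename-≡ z c = x≢c x≡z′
... | no z≢h   rewrite rename-≢ c z≢h = x∉ (here x≡z′)
∉-rename (z ∷ L) x∉ x≢c (there x∈) = ∉-rename L (x∉ ∘ there) x≢c x∈

count-∷-cong : ∀ {x} z A B → count x A ≡ count x B → count x (z ∷ A) ≡ count x (z ∷ B)
count-∷-cong {x} z A B eq with z ≡ᵇ x
... | true  = cong suc eq
... | false = eq

count-remove-other : ∀ {h k} L → h ≢ k → count h (remove k L) ≡ count h L
count-remove-other []      h≢k = refl
count-remove-other {k = k} (x ∷ L) h≢k with x ≟ k
... | yes refl rewrite remove-≡ x L | count-≢ L (h≢k ∘ sym) = count-remove-other L h≢k
... | no x≢k   rewrite remove-≢ L x≢k = count-∷-cong x (remove k L) L (count-remove-other L h≢k)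

remove-comm : ∀ h k L → remove h (remove k L) ≡ remove k (remove h L)
remove-comm h k []      = refl
remove-comm h k (x ∷ L) with x ≟ h | x ≟ k
... | yes refl | yes refl = refl
... | yes refl | no x≢k rewrite remove-≢ L x≢k | remove-≡ x (remove k L) | remove-≡ x L = remove-comm x k L
... | no x≢h | yes refl rewrite remove-≢ L x≢h | remove-≡ x (remove h L) | remove-≡ x L = remove-comm h x L
... | no x≢h | no x≢k
  rewrite remove-≢ L x≢k | remove-≢ (remove k L) x≢h | remove-≢ L x≢h | remove-≢ (remove h L) x≢k =
  cong (x ∷_) (remove-comm h k L)

count-rename-target : ∀ {h c} L → h ≢ c → count c (map (rename h c) L) ≡ count h L ℕ.+ count c L
count-rename-target []      h≢c = refl
count-rename-target {h} {c} (x ∷ L) h≢c with x ≟ h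
... | yes refl rewrite rename-≡ x c | count-≡ c (map (rename x c) L) | count-≡ x L | count-≢ L h≢c =
  cong suc (count-rename-target L h≢c)
... | no x≢h rewrite rename-≢ c x≢h with x ≟ c
...   | yes refl rewrite count-≡ x (map (rename h x) L) | count-≡ x L | count-≢ L (h≢c ∘ sym) =
  trans (cong suc (count-rename-target L h≢c)) (sym (ℕₚ.+-suc (count h L) (count x L)))
...   | no x≢c rewrite count-≢ (map (rename h c) L) x≢c | count-≢ L x≢c | count-≢ L x≢h =
  count-rename-target L h≢c

count-rename-other : ∀ {x h c} L → x ≢ h → x ≢ c → count x (map (rename h c) L) ≡ count x L
count-rename-other []      x≢h x≢c = refl
count-rename-other {h = h} {c} (z ∷ L) x≢h x≢c with z ≟ h
... | yes refl rewrite rename-≡ z c | count-≢ (map (rename z c) L) (x≢c ∘ sym) | count-≢ L (x≢h ∘ sym) =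
  count-rename-other L x≢h x≢c
... | no z≢h rewrite rename-≢ c z≢h = count-∷-cong z (map (rename h c) L) L (count-rename-other L x≢h x≢c)

remove-rename : ∀ {h c} L → h ≢ c → remove c (map (rename h c) L) ≡ remove h (remove c L)
remove-rename []      h≢c = refl
remove-rename {h} {c} (x ∷ L) h≢c with x ≟ h
... | yes refl
  rewrite rename-≡ x c | remove-≡ c (map (rename x c) L) | remove-≢ L h≢c | remove-≡ x (remove c L) =
  remove-rename L h≢c
... | no x≢h rewrite rename-≢ c x≢h with x ≟ c
...   | yes refl rewrite remove-≡ x (map (rename h x) L) | remove-≡ x L = remove-rename L h≢c
...   | no x≢c rewrite remove-≢ (map (rename h c) L) x≢c | remove-≢ L x≢c | remove-≢ (remove c L) x≢h =
  cong (x ∷_) (remove-rename L h≢c)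

remove-rename-other : ∀ {w h c} L → w ≢ h → w ≢ c →
  remove w (map (rename h c) L) ≡ map (rename h c) (remove w L)
remove-rename-other []      w≢h w≢c = refl
remove-rename-other {w} {h} {c} (x ∷ L) w≢h w≢c with x ≟ h
... | yes refl rewrite rename-≡ x c | remove-≢ (map (rename x c) L) (w≢c ∘ sym) | remove-≢ L (w≢h ∘ sym)
                     | rename-≡ x c = cong (c ∷_) (remove-rename-other L w≢h w≢c)
... | no x≢h rewrite rename-≢ c x≢h with x ≟ w
...   | yes refl rewrite remove-≡ x (map (rename h c) L) | remove-≡ x L = remove-rename-other L w≢h w≢c
...   | no x≢w rewrite remove-≢ (map (rename h c) L) x≢w | remove-≢ L x≢w | rename-≢ c x≢h =
  cong (x ∷_) (remove-rename-other L w≢h w≢c)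

length-remove : ∀ h L → length (remove h L) ≤ length L
length-remove h []      = z≤n
length-remove h (x ∷ L) with x ≡ᵇ h
... | true  = ℕₚ.m≤n⇒m≤1+n (length-remove h L)
... | false = s≤s (length-remove h L)

∈-∖⁻ : ∀ {x} L vs → x ∈ L ∖ vs → x ∈ L × x ∉ vs
∈-∖⁻ L []       x∈ = x∈ , λ ()
∈-∖⁻ L (v ∷ vs) x∈ with ∈-remove⁻ (L ∖ vs) x∈
... | x∈′ , x≢v with ∈-∖⁻ L vs x∈′
...   | x∈L , x∉vs = x∈L , λ { (here x≡v) → x≢v x≡v ; (there x∈vs) → x∉vs x∈vs }

∖-covered : ∀ L vs → All (_∈ vs) L → L ∖ vs ≡ []
∖-covered L vs L⊆vs with L ∖ vs | (λ {x} → ∈-∖⁻ {x} L vs)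
... | []    | _   = refl
... | x ∷ _ | mem with mem (here refl)
...   | x∈L , x∉vs = ⊥-elim (x∉vs (All.lookup L⊆vs x∈L))

∉-∖ : ∀ {x} L vs → x ∉ L → x ∉ L ∖ vs
∉-∖ L vs x∉L = x∉L ∘ proj₁ ∘ ∈-∖⁻ L vs

count-∖ : ∀ {x} L vs → x ∉ vs → count x (L ∖ vs) ≡ count x L
count-∖ L []       x∉vs = refl
count-∖ L (v ∷ vs) x∉vs =
  trans (count-remove-other (L ∖ vs) (x∉vs ∘ here)) (count-∖ L vs (x∉vs ∘ there))

∖-rename : ∀ {h c} L ws → h ∉ ws → c ∉ ws → map (rename h c) L ∖ ws ≡ map (rename h c) (L ∖ ws)
∖-rename L []       h∉ws c∉ws = refl
∖-rename L (w ∷ ws) h∉ws c∉ws =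
  trans (cong (remove w) (∖-rename L ws (h∉ws ∘ there) (c∉ws ∘ there)))
        (remove-rename-other (L ∖ ws) (∈-∉⇒≢ (here refl) h∉ws) (∈-∉⇒≢ (here refl) c∉ws))

⊆-rename : ∀ {h} c L vs → All (_∈ L) vs → h ∉ vs → All (_∈ map (rename h c) L) vs
⊆-rename c L vs vs⊆L h∉vs =
  All.tabulate λ w∈vs → ∈-rename⁺ c L (All.lookup vs⊆L w∈vs) (∈-∉⇒≢ w∈vs h∉vs)

∖-contract : ∀ {u v} L ws → u ≢ v → u ∉ ws → v ∉ ws →
  map (rename v u) L ∖ (u ∷ ws) ≡ L ∖ (u ∷ v ∷ ws)
∖-contract {u} {v} L ws u≢v u∉ws v∉ws =
  trans (cong (remove u) (∖-rename L ws v∉ws u∉ws))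
        (trans (remove-rename (L ∖ ws) (u≢v ∘ sym)) (remove-comm v u (L ∖ ws)))

counts-rename : ∀ {h c} L ws → h ∉ ws → c ∉ ws →
  map (λ w → count w (map (rename h c) L)) ws ≡ map (λ w → count w L) ws
counts-rename L ws h∉ws c∉ws =
  map-cong-local (All.tabulate λ w∈ws →
    count-rename-other L (∈-∉⇒≢ w∈ws h∉ws) (∈-∉⇒≢ w∈ws c∉ws))

relabel-contract : ∀ {v c} u ws L → v ∉ ws → c ≢ v →
  relabel (rename v u) (path (v ∷ ws) ++ star c L) ≡ path (u ∷ ws) ++ star c (map (rename v u) L)
relabel-contract {v} {c} u ws L v∉ws c≢v =
  trans (map-++ _ (path (v ∷ ws)) (star c L))
        (cong₂ _++_ (trans (relabel-path (rename v u) (v ∷ ws))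
                           (cong path (cong₂ _∷_ (rename-≡ v u) (rename-∉ u ws v∉ws))))
                    (trans (relabel-star (rename v u) c L)
                           (cong (λ c′ → star c′ (map (rename v u) L)) (rename-≢ u c≢v))))

count-++ : ∀ v A B → count v (A ++ B) ≡ count v A ℕ.+ count v B
count-++ v []      B = refl
count-++ v (x ∷ A) B with x ≡ᵇ v
... | true  = cong suc (count-++ v A B)
... | false = count-++ v A B

count-unique : ∀ {v} L → Unique L → v ∈ L → count v L ≡ 1
count-unique (x ∷ L) (x≢L ∷ _) (here refl) rewrite count-≡ x L | count-∉ L (All¬⇒¬Any x≢L) = refl
count-unique (x ∷ L) (x≢L ∷ unique) (there v∈L)
  rewrite count-≢ L (All.lookup x≢L v∈L) = count-unique L unique v∈L

count-spokes : ∀ {v} n E → v ℕ.< n → count v (upTo n ++ E) ≡ suc (count v E)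
count-spokes {v} n E v<n =
  trans (count-++ v (upTo n) E) (cong (ℕ._+ count v E) (count-unique (upTo n) (upTo⁺ n) (∈-upTo⁺ v<n)))

counts-ones : ∀ L vs → All (λ v → count v L ≡ 1) vs →
  map (λ v → count v L) vs ≡ replicate (length vs) 1
counts-ones L []       []            = refl
counts-ones L (v ∷ vs) (once ∷ once′) = cong₂ _∷_ once (counts-ones L vs once′)

once-each : ∀ L m → (∀ {i} → i ℕ.< m → count (suc i) L ≡ 1) →
  map (λ v → count v L) (applyUpTo suc m) ≡ replicate m 1
once-each L m once =
  trans (counts-ones L (applyUpTo suc m) (applyUpTo⁺₁ suc m once))
        (cong (λ k → replicate k 1) (length-applyUpTo suc m))

even-double : ∀ m → even (2 ℕ.* m) ≡ true
even-double zero    = refl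
even-double (suc m) = trans (cong even (ℕₚ.*-suc 2 m)) (even-double m)

odd-suc-double : ∀ m → even (suc (2 ℕ.* m)) ≡ false
odd-suc-double zero    = refl
odd-suc-double (suc m) = trans (cong (even ∘ suc) (ℕₚ.*-suc 2 m)) (odd-suc-double m)

module _ (y : ℤ) where

  -- Evaluation at x = 1 of stars

  T : (ℕ → ℕ) → Graph → ℤ
  T σ E = tutteAux σ E (int 1) y

  Tstar : ℕ → List ℕ → ℤ
  Tstar c L = T id (star c L)

  -- The value at x = 1 of k parallel edges (the empty graph for k = 0).
  bundle : ℕ → ℤ
  bundle zero          = int 1
  bundle (suc zero)    = int 1
  bundle (suc (suc k)) = bundle (suc k) + y ^ suc k

  bundle-step : ∀ k → 0 ℕ.< k → bundle k + y ^ k ≡ bundle (suc k)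
  bundle-step (suc k) _ = refl

  T-loop : ∀ σ a b E → σ a ≡ σ b → T σ ((a , b) ∷ E) ≡ y * T σ E
  T-loop σ a b E σa≡σb rewrite σa≡σb | ≡ᵇ-refl (σ b) = refl

  T-bridge : ∀ σ a b E → σ a ≢ σ b → connected σ E a b ≡ false →
    T σ ((a , b) ∷ E) ≡ T (merge σ a b) E
  T-bridge σ a b E σa≢σb disconnected
    rewrite ≢⇒≡ᵇ-false σa≢σb | disconnected = ℤₚ.*-identityˡ _

  T-cycle : ∀ σ a b E → σ a ≢ σ b → connected σ E a b ≡ true →
    T σ ((a , b) ∷ E) ≡ T σ E + T (merge σ a b) E
  T-cycle σ a b E σa≢σb connected rewrite ≢⇒≡ᵇ-false σa≢σb | connected = refl

  -- merge id c h is rename h c, so contracting a spoke is a relabelling of the leaves.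
  Tstar-contract : ∀ {h c} L → h ≢ c → T (merge id c h) (star c L) ≡ Tstar c (map (rename h c) L)
  Tstar-contract {h} {c} L h≢c = begin
    T (merge id c h) (star c L)
      ≡⟨ tutteAux-relabel id (rename h c) (star c L) (int 1) y ⟩
    T id (relabel (rename h c) (star c L))
      ≡⟨ cong (T id) (relabel-star (rename h c) c L) ⟩
    T id (star (rename h c c) (map (rename h c) L))
      ≡⟨ cong (λ c′ → T id (star c′ (map (rename h c) L))) (rename-≢ c (h≢c ∘ sym)) ⟩
    Tstar c (map (rename h c) L) ∎

  Tstar-cycle : ∀ {h c} L → h ≢ c → h ∈ L →
    Tstar c (h ∷ L) ≡ Tstar c L + Tstar c (map (rename h c) L)
  Tstar-cycle {h} {c} L h≢c h∈L =
    trans (T-cycle id c h (star c L) (h≢c ∘ sym)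
                   (connected-star-leaves id c L c h (inj₂ refl) (inj₁ h∈L)))
          (cong (Tstar c L +_) (Tstar-contract L h≢c))

  Tstar-bridge : ∀ {h c} L → h ≢ c → h ∉ L → Tstar c (h ∷ L) ≡ Tstar c L
  Tstar-bridge {h} {c} L h≢c h∉L =
    trans (T-bridge id c h (star c L) (h≢c ∘ sym)
                    (connected-star-apart id c L h h≢c (All.map (_∘ sym) (¬Any⇒All¬ L h∉L))))
          (trans (Tstar-contract L h≢c) (cong (Tstar c) (rename-∉ c L h∉L)))

  -- The recursion is on the length of L, since contraction only renames leaves.
  Tstar-loops : ∀ c L → Tstar c L ≡ y ^ count c L * Tstar c (remove c L)
  Tstar-loops c L = loops (length L) L ℕₚ.≤-refl
    where
    pull-out : ∀ (u v a b : ℤ) → u * a + (v * u) * b ≡ u * (a + v * b)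
    pull-out = solve-∀
    loops : ∀ k L → length L ≤ k → Tstar c L ≡ y ^ count c L * Tstar c (remove c L)
    loops k       []      _           = refl
    loops (suc k) (x ∷ L) (s≤s |L|≤k) with x ≟ c
    ... | yes refl rewrite count-≡ x L | remove-≡ x L =
      trans (T-loop id x x (star x L) refl)
            (trans (cong (y *_) (loops k L |L|≤k)) (sym (ℤₚ.*-assoc y _ _)))
    ... | no x≢c rewrite count-≢ L x≢c | remove-≢ L x≢c with x ∈? L
    ...   | no x∉L =
      trans (Tstar-bridge L x≢c x∉L)
            (trans (loops k L |L|≤k)
                   (cong (y ^ count c L *_) (sym (Tstar-bridge (remove c L) x≢c (∉-remove L x∉L)))))
    ...   | yes x∈L = begin
      Tstar c (x ∷ L)
        ≡⟨ Tstar-cycle L x≢c x∈L ⟩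
      Tstar c L + Tstar c (map (rename x c) L)
        ≡⟨ cong₂ _+_ (loops k L |L|≤k) (redirect L |L|≤k) ⟩
      y ^ p * Tstar c R + y ^ (q ℕ.+ p) * Tstar c (remove x R)
        ≡⟨ cong (λ e → y ^ p * Tstar c R + e * Tstar c (remove x R)) (ℤₚ.^-distribˡ-+-* y q p) ⟩
      y ^ p * Tstar c R + (y ^ q * y ^ p) * Tstar c (remove x R)
        ≡⟨ pull-out (y ^ p) (y ^ q) _ _ ⟩
      y ^ p * (Tstar c R + y ^ q * Tstar c (remove x R))
        ≡⟨ cong (λ t → y ^ p * (Tstar c R + t)) (sym redirect-R) ⟩
      y ^ p * (Tstar c R + Tstar c (map (rename x c) R))
        ≡⟨ cong (y ^ p *_) (sym (Tstar-cycle R x≢c (∈-remove⁺ L x∈L x≢c))) ⟩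
      y ^ p * Tstar c (x ∷ R) ∎
      where
      p = count c L
      q = count x L
      R = remove c L
      redirect : ∀ M → length M ≤ k →
        Tstar c (map (rename x c) M) ≡ y ^ (count x M ℕ.+ count c M) * Tstar c (remove x (remove c M))
      redirect M |M|≤k =
        trans (loops k (map (rename x c) M) (subst (_≤ k) (sym (length-map _ M)) |M|≤k))
              (cong₂ (λ e M′ → y ^ e * Tstar c M′) (count-rename-target M x≢c) (remove-rename M x≢c))
      redirect-R : Tstar c (map (rename x c) R) ≡ y ^ q * Tstar c (remove x R)
      redirect-R =
        trans (redirect R (ℕₚ.≤-trans (length-remove c L) |L|≤k))
              (cong₂ (λ e M′ → y ^ e * Tstar c (remove x M′))
                     (trans (cong₂ ℕ._+_ (count-remove-other L x≢c) (count-∉ R (remove-∌ c L)))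
                            (ℕₚ.+-identityʳ q))
                     (remove-∉ R (remove-∌ c L)))

  Tstar-redirect : ∀ {h c} M → h ≢ c → c ∉ M →
    Tstar c (map (rename h c) M) ≡ y ^ count h M * Tstar c (remove h M)
  Tstar-redirect {h} {c} M h≢c c∉M = begin
    Tstar c (map (rename h c) M)
      ≡⟨ Tstar-loops c (map (rename h c) M) ⟩
    y ^ count c (map (rename h c) M) * Tstar c (remove c (map (rename h c) M))
      ≡⟨ cong₂ (λ e M′ → y ^ e * Tstar c M′) (count-rename-target M h≢c) (remove-rename M h≢c) ⟩
    y ^ (count h M ℕ.+ count c M) * Tstar c (remove h (remove c M))
      ≡⟨ cong₂ (λ e M′ → y ^ (count h M ℕ.+ e) * Tstar c (remove h M′))
               (count-∉ M c∉M) (remove-∉ M c∉M) ⟩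
    y ^ (count h M ℕ.+ 0) * Tstar c (remove h M)
      ≡⟨ cong (λ e → y ^ e * Tstar c (remove h M)) (ℕₚ.+-identityʳ (count h M)) ⟩
    y ^ count h M * Tstar c (remove h M) ∎

  Tstar-bundle : ∀ {h c} L → h ≢ c → c ∉ L → Tstar c L ≡ bundle (count h L) * Tstar c (remove h L)
  Tstar-bundle {h} {c} L h≢c = bundles (length L) L ℕₚ.≤-refl
    where
    factor : ∀ (b u s t : ℤ) → b * s + u * (b * t) ≡ b * (s + u * t)
    factor = solve-∀
    bundles : ∀ k L → length L ≤ k → c ∉ L → Tstar c L ≡ bundle (count h L) * Tstar c (remove h L)
    bundles k       []      _           _    = refl
    bundles (suc k) (x ∷ L) (s≤s |L|≤k) c∉xL with x ≟ h | x ∈? L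
    ... | yes refl | no x∉L rewrite count-≡ x L | remove-≡ x L | count-∉ L x∉L = begin
      Tstar c (x ∷ L)             ≡⟨ Tstar-bridge L h≢c x∉L ⟩
      Tstar c L                   ≡⟨ cong (Tstar c) (sym (remove-∉ L x∉L)) ⟩
      Tstar c (remove x L)        ≡⟨ sym (ℤₚ.*-identityˡ _) ⟩
      int 1 * Tstar c (remove x L) ∎
    ... | yes refl | yes x∈L rewrite count-≡ x L | remove-≡ x L = begin
      Tstar c (x ∷ L)
        ≡⟨ Tstar-cycle L h≢c x∈L ⟩
      Tstar c L + Tstar c (map (rename x c) L)
        ≡⟨ cong₂ _+_ (bundles k L |L|≤k (c∉xL ∘ there)) (Tstar-redirect L h≢c (c∉xL ∘ there)) ⟩
      bundle q * Tstar c R + y ^ q * Tstar c R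
        ≡⟨ sym (ℤₚ.*-distribʳ-+ (Tstar c R) (bundle q) (y ^ q)) ⟩
      (bundle q + y ^ q) * Tstar c R
        ≡⟨ cong (_* Tstar c R) (bundle-step q (count-∈ L x∈L)) ⟩
      bundle (suc q) * Tstar c R ∎
      where
      q = count x L
      R = remove x L
    ... | no x≢h | no x∉L rewrite count-≢ L x≢h | remove-≢ L x≢h = begin
      Tstar c (x ∷ L)
        ≡⟨ Tstar-bridge L x≢c x∉L ⟩
      Tstar c L
        ≡⟨ bundles k L |L|≤k (c∉xL ∘ there) ⟩
      bundle (count h L) * Tstar c (remove h L)
        ≡⟨ cong (bundle (count h L) *_) (sym (Tstar-bridge (remove h L) x≢c (∉-remove L x∉L))) ⟩
      bundle (count h L) * Tstar c (x ∷ remove h L) ∎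
      where
      x≢c = ∈-∉⇒≢ (here refl) c∉xL
    ... | no x≢h | yes x∈L rewrite count-≢ L x≢h | remove-≢ L x≢h = begin
      Tstar c (x ∷ L)
        ≡⟨ Tstar-cycle L x≢c x∈L ⟩
      Tstar c L + Tstar c (map (rename x c) L)
        ≡⟨ cong₂ _+_ (bundles k L |L|≤k c∉L) (Tstar-redirect L x≢c c∉L) ⟩
      b * Tstar c R + y ^ count x L * Tstar c (remove x L)
        ≡⟨ cong (λ t → b * Tstar c R + y ^ count x L * t) bundle-rest ⟩
      b * Tstar c R + y ^ count x L * (b * Tstar c (remove x R))
        ≡⟨ factor b (y ^ count x L) _ _ ⟩
      b * (Tstar c R + y ^ count x L * Tstar c (remove x R))
        ≡⟨ cong (λ e → b * (Tstar c R + y ^ e * Tstar c (remove x R))) (sym (count-remove-other L x≢h)) ⟩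
      b * (Tstar c R + y ^ count x R * Tstar c (remove x R))
        ≡⟨ cong (λ t → b * (Tstar c R + t)) (sym (Tstar-redirect R x≢c (∉-remove L c∉L))) ⟩
      b * (Tstar c R + Tstar c (map (rename x c) R))
        ≡⟨ cong (b *_) (sym (Tstar-cycle R x≢c (∈-remove⁺ L x∈L x≢h))) ⟩
      b * Tstar c (x ∷ R) ∎
      where
      c∉L = c∉xL ∘ there
      x≢c = ∈-∉⇒≢ (here refl) c∉xL
      b = bundle (count h L)
      R = remove h L
      bundle-rest : Tstar c (remove x L) ≡ b * Tstar c (remove x R)
      bundle-rest =
        trans (bundles k (remove x L) (ℕₚ.≤-trans (length-remove x L) |L|≤k) (∉-remove L c∉L))
              (cong₂ (λ e M → bundle e * Tstar c M) (count-remove-other L (x≢h ∘ sym)) (remove-comm h x L))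

  -- Cones over paths

  fan : ℕ → List ℕ → ℤ
  fan s []       = bundle s
  fan s (t ∷ ts) = bundle s * fan t ts + fan (t ℕ.+ s) ts

  Tpath-star : ∀ {c} u vs L → Unique (u ∷ vs) → All (_∈ L) (u ∷ vs) → c ∉ L →
    T id (path (u ∷ vs) ++ star c L) ≡
    Tstar c (L ∖ (u ∷ vs)) * fan (count u L) (map (λ v → count v L) vs)
  Tpath-star u [] L _ (u∈L ∷ []) c∉L =
    trans (Tstar-bundle L (∈-∉⇒≢ u∈L c∉L) c∉L) (ℤₚ.*-comm (bundle (count u L)) _)
  Tpath-star {c} u (v ∷ ws) L (u≢vws@(u≢v ∷ u≢ws) ∷ vws-unique@(v≢ws ∷ ws-unique))
                              (u∈L ∷ vws⊆L@(v∈L ∷ ws⊆L)) c∉L = begin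
    T id ((u , v) ∷ rest)
      ≡⟨ T-cycle id u v rest u≢v u~v ⟩
    T id rest + T (merge id u v) rest
      ≡⟨ cong₂ _+_ deleted contracted ⟩
    (bundle a * S) * fan b cs + S * fan (b ℕ.+ a) cs
      ≡⟨ factor (bundle a) S (fan b cs) (fan (b ℕ.+ a) cs) ⟩
    S * fan a (b ∷ cs) ∎
    where
    factor : ∀ (p s f g : ℤ) → (p * s) * f + s * g ≡ s * (p * f + g)
    factor = solve-∀
    rest = path (v ∷ ws) ++ star c L
    a = count u L
    b = count v L
    cs = map (λ w → count w L) ws
    S = Tstar c (L ∖ (u ∷ v ∷ ws))
    L′ = map (rename v u) L
    u∉ws = All¬⇒¬Any u≢ws
    v∉ws = All¬⇒¬Any v≢ws
    u~v : connected id rest u v ≡ true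
    u~v = trans (connected-++ id (path (v ∷ ws)) (star c L) u v)
                (connected-star-leaves _ c L u v (inj₁ u∈L) (inj₁ v∈L))
    deleted : T id rest ≡ (bundle a * S) * fan b cs
    deleted = begin
      T id rest
        ≡⟨ Tpath-star v ws L vws-unique vws⊆L c∉L ⟩
      Tstar c (L ∖ (v ∷ ws)) * fan b cs
        ≡⟨ cong (_* fan b cs)
                (Tstar-bundle (L ∖ (v ∷ ws)) (∈-∉⇒≢ u∈L c∉L) (∉-∖ L (v ∷ ws) c∉L)) ⟩
      (bundle (count u (L ∖ (v ∷ ws))) * S) * fan b cs
        ≡⟨ cong (λ e → (bundle e * S) * fan b cs) (count-∖ L (v ∷ ws) (All¬⇒¬Any u≢vws)) ⟩
      (bundle a * S) * fan b cs ∎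
    contracted : T (merge id u v) rest ≡ S * fan (b ℕ.+ a) cs
    contracted = begin
      T (merge id u v) rest
        ≡⟨ tutteAux-relabel id (rename v u) rest (int 1) y ⟩
      T id (relabel (rename v u) rest)
        ≡⟨ cong (T id) (relabel-contract u ws L v∉ws (∈-∉⇒≢ v∈L c∉L ∘ sym)) ⟩
      T id (path (u ∷ ws) ++ star c L′)
        ≡⟨ Tpath-star u ws L′ (u≢ws ∷ ws-unique)
                      (⊆-rename u L (u ∷ ws) (u∈L ∷ ws⊆L) (All¬⇒¬Any ((u≢v ∘ sym) ∷ v≢ws)))
                      (∉-rename L c∉L (∈-∉⇒≢ u∈L c∉L ∘ sym)) ⟩
      Tstar c (L′ ∖ (u ∷ ws)) * fan (count u L′) (map (λ w → count w L′) ws)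
        ≡⟨ cong₂ (λ M e → Tstar c M * fan e (map (λ w → count w L′) ws))
                 (∖-contract L ws u≢v u∉ws v∉ws) (count-rename-target L (u≢v ∘ sym)) ⟩
      S * fan (b ℕ.+ a) (map (λ w → count w L′) ws)
        ≡⟨ cong (λ ts → S * fan (b ℕ.+ a) ts) (counts-rename L ws v∉ws u∉ws) ⟩
      S * fan (b ℕ.+ a) cs ∎

  Tcone : ∀ m L → All (_∈ L) (upTo (suc m)) → All (_∈ upTo (suc m)) L →
    T id (path (upTo (suc m)) ++ star (suc m) L) ≡
    fan (count 0 L) (map (λ v → count v L) (applyUpTo suc m))
  Tcone m L spanning covered = begin
    T id (path (upTo (suc m)) ++ star (suc m) L)
      ≡⟨ Tpath-star 0 (applyUpTo suc m) L (upTo⁺ (suc m)) spanning centre∉L ⟩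
    Tstar (suc m) (L ∖ upTo (suc m)) * fan (count 0 L) counts
      ≡⟨ cong (λ M → Tstar (suc m) M * fan (count 0 L) counts) (∖-covered L (upTo (suc m)) covered) ⟩
    int 1 * fan (count 0 L) counts
      ≡⟨ ℤₚ.*-identityˡ _ ⟩
    fan (count 0 L) counts ∎
    where
    counts = map (λ v → count v L) (applyUpTo suc m)
    centre∉L : suc m ∉ L
    centre∉L centre∈L = ℕₚ.<-irrefl refl (∈-upTo⁻ (All.lookup covered centre∈L))

  -- Evaluation of the fans

  bundle-suc-suc : ∀ s → bundle (suc (suc s)) ≡ int 1 + y * bundle (suc s)
  bundle-suc-suc zero    = refl
  bundle-suc-suc (suc s) = begin
    bundle (suc (suc s)) + y ^ suc (suc s)
      ≡⟨ cong (_+ y ^ suc (suc s)) (bundle-suc-suc s) ⟩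
    (int 1 + y * bundle (suc s)) + y * y ^ suc s
      ≡⟨ regroup y (bundle (suc s)) (y ^ suc s) ⟩
    int 1 + y * (bundle (suc s) + y ^ suc s) ∎
    where
    regroup : ∀ (y b p : ℤ) → (int 1 + y * b) + y * p ≡ int 1 + y * (b + p)
    regroup = solve-∀

  -- Unfolding the leading 1 and using bundle (2 + s) = 1 + y · bundle (1 + s) turns
  -- the coefficients (a m, a (1 + m) − a m) into (a (1 + m), a (2 + m) − a (1 + m)).
  fan-ones : ∀ (a : ℕ → ℤ) t →
    (∀ m → a (suc (suc m)) ≡ (int 2 + y) * a (suc m) - y * a m) →
    (∀ s → fan (suc s) t ≡ a 0 + bundle (suc s) * (a 1 - a 0)) →
    ∀ m s → fan (suc s) (replicate m 1 ++ t) ≡ a m + bundle (suc s) * (a (suc m) - a m)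
  fan-ones a t recurrence base zero    s = base s
  fan-ones a t recurrence base (suc m) s = begin
    B * fan 1 ts + fan (suc (suc s)) ts
      ≡⟨ cong₂ (λ p q → B * p + q) (fan-ones a t recurrence base m 0)
                                   (fan-ones a t recurrence base m (suc s)) ⟩
    B * (a m + int 1 * d) + (a m + bundle (suc (suc s)) * d)
      ≡⟨ cong (λ β → B * (a m + int 1 * d) + (a m + β * d)) (bundle-suc-suc s) ⟩
    B * (a m + int 1 * d) + (a m + (int 1 + y * B) * d)
      ≡⟨ expand y B (a m) (a (suc m)) ⟩
    a (suc m) + B * (((int 2 + y) * a (suc m) - y * a m) - a (suc m))
      ≡⟨ cong (λ r → a (suc m) + B * (r - a (suc m))) (sym (recurrence m)) ⟩
    a (suc m) + B * (a (suc (suc m)) - a (suc m)) ∎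
    where
    B = bundle (suc s)
    d = a (suc m) - a m
    ts = replicate m 1 ++ t
    expand : ∀ (y B p q : ℤ) → B * (p + int 1 * (q - p)) + (p + (int 1 + y * B) * (q - p)) ≡
                               q + B * (((int 2 + y) * q - y * p) - q)
    expand = solve-∀

  evenF oddF : ℕ → ℤ
  evenF m = F (2 ℕ.* m) y
  oddF  m = F (suc (2 ℕ.* m)) y

  evenF-suc : ∀ m → evenF (suc m) ≡ oddF m + evenF m
  evenF-suc m = begin
    evenF (suc m)
      ≡⟨ cong (λ k → F k y) (ℕₚ.*-suc 2 m) ⟩
    oddF m + (if even (2 ℕ.* m) then int 1 else y) * evenF m
      ≡⟨ cong (λ b → oddF m + (if b then int 1 else y) * evenF m) (even-double m) ⟩
    oddF m + int 1 * evenF m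
      ≡⟨ cong (oddF m +_) (ℤₚ.*-identityˡ (evenF m)) ⟩
    oddF m + evenF m ∎

  oddF-suc : ∀ m → oddF (suc m) ≡ evenF (suc m) + y * oddF m
  oddF-suc m = begin
    oddF (suc m)
      ≡⟨ cong (λ k → F (suc k) y) (ℕₚ.*-suc 2 m) ⟩
    F (2 ℕ.+ 2 ℕ.* m) y + (if even (suc (2 ℕ.* m)) then int 1 else y) * oddF m
      ≡⟨ cong (λ b → F (2 ℕ.+ 2 ℕ.* m) y + (if b then int 1 else y) * oddF m) (odd-suc-double m) ⟩
    F (2 ℕ.+ 2 ℕ.* m) y + y * oddF m
      ≡⟨ cong (λ k → F k y + y * oddF m) (sym (ℕₚ.*-suc 2 m)) ⟩
    evenF (suc m) + y * oddF m ∎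

  evenF-recurrence : ∀ m → evenF (suc (suc m)) ≡ (int 2 + y) * evenF (suc m) - y * evenF m
  evenF-recurrence m = begin
    evenF (suc (suc m))
      ≡⟨ evenF-suc (suc m) ⟩
    oddF (suc m) + evenF (suc m)
      ≡⟨ cong (_+ evenF (suc m)) (oddF-suc m) ⟩
    (evenF (suc m) + y * oddF m) + evenF (suc m)
      ≡⟨ cong (λ e → (e + y * oddF m) + e) (evenF-suc m) ⟩
    ((oddF m + evenF m) + y * oddF m) + (oddF m + evenF m)
      ≡⟨ regroup y (oddF m) (evenF m) ⟩
    (int 2 + y) * (oddF m + evenF m) - y * evenF m
      ≡⟨ cong (λ e → (int 2 + y) * e - y * evenF m) (sym (evenF-suc m)) ⟩
    (int 2 + y) * evenF (suc m) - y * evenF m ∎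
    where
    regroup : ∀ (y o e : ℤ) → ((o + e) + y * o) + (o + e) ≡ (int 2 + y) * (o + e) - y * e
    regroup = solve-∀

  oddF-recurrence : ∀ m → oddF (suc (suc m)) ≡ (int 2 + y) * oddF (suc m) - y * oddF m
  oddF-recurrence m = begin
    oddF (suc (suc m))
      ≡⟨ oddF-suc (suc m) ⟩
    evenF (suc (suc m)) + y * oddF (suc m)
      ≡⟨ cong (_+ y * oddF (suc m)) (evenF-suc (suc m)) ⟩
    (oddF (suc m) + evenF (suc m)) + y * oddF (suc m)
      ≡⟨ cong (λ o → (o + evenF (suc m)) + y * o) (oddF-suc m) ⟩
    ((evenF (suc m) + y * oddF m) + evenF (suc m)) + y * (evenF (suc m) + y * oddF m)
      ≡⟨ regroup y (evenF (suc m)) (oddF m) ⟩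
    (int 2 + y) * (evenF (suc m) + y * oddF m) - y * oddF m
      ≡⟨ cong (λ o → (int 2 + y) * o - y * oddF m) (sym (oddF-suc m)) ⟩
    (int 2 + y) * oddF (suc m) - y * oddF m ∎
    where
    regroup : ∀ (y e o : ℤ) → ((e + y * o) + e) + y * (e + y * o) ≡ (int 2 + y) * (e + y * o) - y * o
    regroup = solve-∀

  fan-ones-evenF : ∀ m s → fan (suc s) (replicate m 1) ≡ evenF m + bundle (suc s) * (evenF (suc m) - evenF m)
  fan-ones-evenF m s =
    trans (cong (fan (suc s)) (sym (++-identityʳ (replicate m 1))))
          (fan-ones evenF [] evenF-recurrence (λ s → just-bundle (bundle (suc s))) m s)
    where
    just-bundle : ∀ (b : ℤ) → b ≡ int 0 + b * (int 1 - int 0)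
    just-bundle = solve-∀

  fan-cone : ∀ m → fan 1 (replicate m 1) ≡ evenF (suc m)
  fan-cone m = trans (fan-ones-evenF m 0) (telescope (evenF m) (evenF (suc m)))
    where
    telescope : ∀ (p q : ℤ) → p + int 1 * (q - p) ≡ q
    telescope = solve-∀

  fan-cone-first : ∀ m → fan 2 (replicate m 1) ≡ oddF (suc m)
  fan-cone-first m = begin
    fan 2 (replicate m 1)
      ≡⟨ fan-ones-evenF m 1 ⟩
    evenF m + (int 1 + y * int 1) * (evenF (suc m) - evenF m)
      ≡⟨ cong (λ e → evenF m + (int 1 + y * int 1) * (e - evenF m)) (evenF-suc m) ⟩
    evenF m + (int 1 + y * int 1) * ((oddF m + evenF m) - evenF m)
      ≡⟨ regroup y (oddF m) (evenF m) ⟩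
    (oddF m + evenF m) + y * oddF m
      ≡⟨ cong (_+ y * oddF m) (sym (evenF-suc m)) ⟩
    evenF (suc m) + y * oddF m
      ≡⟨ sym (oddF-suc m) ⟩
    oddF (suc m) ∎
    where
    regroup : ∀ (y o e : ℤ) → e + (int 1 + y * int 1) * ((o + e) - e) ≡ (o + e) + y * o
    regroup = solve-∀

  fan-cone-last : ∀ m → fan 1 (replicate m 1 ++ 2 ∷ []) ≡ oddF (suc (suc m))
  fan-cone-last m =
    trans (fan-ones (oddF ∘ suc) (2 ∷ []) (oddF-recurrence ∘ suc) base m 0)
          (telescope (oddF (suc m)) (oddF (suc (suc m))))
    where
    telescope : ∀ (p q : ℤ) → p + int 1 * (q - p) ≡ q
    telescope = solve-∀
    expand : ∀ (y b : ℤ) →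
      b * (int 1 + y * int 1) + (int 1 + y * (int 1 + y * b)) ≡
      (int 1 + y * int 1) + b * ((((int 1 + y * int 1) + int 1) + y * (int 1 + y * int 1)) - (int 1 + y * int 1))
    expand = solve-∀
    base : ∀ s → fan (suc s) (2 ∷ []) ≡ oddF 1 + bundle (suc s) * (oddF 2 - oddF 1)
    base s = begin
      bundle (suc s) * (int 1 + y * int 1) + bundle (suc (suc (suc s)))
        ≡⟨ cong (bundle (suc s) * (int 1 + y * int 1) +_)
                (trans (bundle-suc-suc (suc s)) (cong (λ b → int 1 + y * b) (bundle-suc-suc s))) ⟩
      bundle (suc s) * (int 1 + y * int 1) + (int 1 + y * (int 1 + y * bundle (suc s)))
        ≡⟨ expand y (bundle (suc s)) ⟩
      oddF 1 + bundle (suc s) * (oddF 2 - oddF 1) ∎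

  Tcone-path : ∀ m → T id (conePath (suc m)) ≡ evenF (suc m)
  Tcone-path m = begin
    T id (conePath (suc m))
      ≡⟨ cong (T id) (conePath-spokes (suc m)) ⟩
    T id (path (upTo (suc m)) ++ star (suc m) L)
      ≡⟨ Tcone m L (All.tabulate id) (All.tabulate id) ⟩
    fan (count 0 L) (map (λ v → count v L) (applyUpTo suc m))
      ≡⟨ cong₂ fan (once (s≤s z≤n)) (once-each L m (once ∘ s≤s)) ⟩
    fan 1 (replicate m 1)
      ≡⟨ fan-cone m ⟩
    evenF (suc m) ∎
    where
    L = upTo (suc m)
    once : ∀ {v} → v ℕ.< suc m → count v L ≡ 1
    once v<n = count-unique L (upTo⁺ (suc m)) (∈-upTo⁺ v<n)

  Tcone-path-plus-first : ∀ m → T id (conePathPlus (suc m) 0) ≡ oddF (suc m)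
  Tcone-path-plus-first m = begin
    T id (conePathPlus (suc m) 0)
      ≡⟨ cong (T id) (conePathPlus-spokes (suc m) 0) ⟩
    T id (path (upTo (suc m)) ++ star (suc m) L)
      ≡⟨ Tcone m L (All.tabulate ∈-++⁺ˡ) (++⁺ (All.tabulate id) (∈-upTo⁺ (s≤s z≤n) ∷ [])) ⟩
    fan (count 0 L) (map (λ v → count v L) (applyUpTo suc m))
      ≡⟨ cong₂ fan (count-spokes (suc m) (0 ∷ []) (s≤s z≤n))
                   (once-each L m (λ i<m → count-spokes (suc m) (0 ∷ []) (s≤s i<m))) ⟩
    fan 2 (replicate m 1)
      ≡⟨ fan-cone-first m ⟩
    oddF (suc m) ∎
    where
    L = upTo (suc m) ++ 0 ∷ []

  Tcone-path-plus-last : ∀ m → T id (conePathPlus (suc m) m) ≡ oddF (suc m)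
  Tcone-path-plus-last zero    = Tcone-path-plus-first 0
  Tcone-path-plus-last (suc m) = begin
    T id (conePathPlus (suc (suc m)) (suc m))
      ≡⟨ cong (T id) (conePathPlus-spokes (suc (suc m)) (suc m)) ⟩
    T id (path (upTo (suc (suc m))) ++ star (suc (suc m)) L)
      ≡⟨ Tcone (suc m) L (All.tabulate ∈-++⁺ˡ)
               (++⁺ (All.tabulate id) (∈-upTo⁺ ℕₚ.≤-refl ∷ [])) ⟩
    fan (count 0 L) (map (λ v → count v L) (applyUpTo suc (suc m)))
      ≡⟨ cong₂ fan (count-spokes (suc (suc m)) (suc m ∷ []) (s≤s z≤n)) counts ⟩
    fan 1 (replicate m 1 ++ 2 ∷ [])
      ≡⟨ fan-cone-last m ⟩
    oddF (suc (suc m)) ∎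
    where
    L = upTo (suc (suc m)) ++ suc m ∷ []
    once : ∀ {i} → i ℕ.< m → count (suc i) L ≡ 1
    once i<m = trans (count-spokes (suc (suc m)) (suc m ∷ []) (s≤s (ℕₚ.m<n⇒m<1+n i<m)))
                     (cong suc (count-≢ [] (ℕₚ.<⇒≢ (s≤s i<m) ∘ sym)))
    twice : count (suc m) L ≡ 2
    twice = trans (count-spokes (suc (suc m)) (suc m ∷ []) ℕₚ.≤-refl) (cong suc (count-≡ (suc m) []))
    counts : map (λ v → count v L) (applyUpTo suc (suc m)) ≡ replicate m 1 ++ 2 ∷ []
    counts = begin
      map (λ v → count v L) (applyUpTo suc (suc m))
        ≡⟨ cong (map (λ v → count v L)) (sym (applyUpTo-∷ʳ suc m)) ⟩
      map (λ v → count v L) (applyUpTo suc m ++ suc m ∷ [])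
        ≡⟨ map-++ (λ v → count v L) (applyUpTo suc m) (suc m ∷ []) ⟩
      map (λ v → count v L) (applyUpTo suc m) ++ count (suc m) L ∷ []
        ≡⟨ cong₂ (λ ts t → ts ++ t ∷ []) (once-each L m once) twice ⟩
      replicate m 1 ++ 2 ∷ [] ∎

corollary3p6 : (n : ℕ) → 1 ≤ n → (y : ℤ) →
    (tutte (conePath n) (int 1) y ≡ F (2 ℕ.* n) y)
    × ((ℓ : ℕ) → (ℓ ≡ 0 ⊎ ℓ ≡ n ℕ.∸ 1) →
       tutte (conePathPlus n ℓ) (int 1) y ≡ F (suc (2 ℕ.* n)) y)
corollary3p6 (suc m) _ y = Tcone-path y m , λ where
  _ (inj₁ refl) → Tcone-path-plus-first y m
  _ (inj₂ refl) → Tcone-path-plus-last y m
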